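{- The total Roman $\{2\}$-domination problem (computing, for a graph $G$ without isolated vertices, the minimum weight $\gamma_{tR2}(G)$ of a total Roman $\{2\}$-dominating function of $G$) is a LinEMSOL$(\tau_1)$ optimization problem.
   Context: All graphs are finite and simple. For a function $f:V(G)\to\{0,1,2\}$ write $V_i=\{v: f(v)=i\}$. $f$ is a total Roman $\{2\}$-dominating function if every vertex $v$ with $f(v)=0$ has a neighbor $u$ with $f(u)=2$ or two distinct neighbors $x,y$ with $f(x)=f(y)=1$, and the subgraph induced by $V_1\cup V_2$ has no isolated vertices; its weight is $\sum_v f(v)$. MSOL$(\tau_1)$ denotes monadic second order logic over the structure $G(\tau_1)=\langle V(G),R\rangle$, where $R$ is the binary relation with $R(u,v)$ iff $uv\in E(G)$, allowing quantification over vertices and over subsets of vertices. An optimization problem on graphs is a LinEMSOL$(\tau_1)$ optimization problem if it can be written as $\mathrm{Opt}\{\sum_{1\le i\le l} a_i|X_i| : \langle G(\tau_1),X_1,\ldots,X_l\rangle \vDash \theta(X_1,\ldots,X_l)\}$, where $\theta$ is an MSOL$(\tau_1)$ formula with free set variables $X_1,\ldots,X_l$ (ranging over subsets of $V(G)$), the $a_i$ are integers, and $\mathrm{Opt}\in\{\min,\max\}$. -}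

module Defs where

open import Data.Nat using (ℕ; zero; suc)
open import Data.Fin using (Fin; toℕ)
open import Data.Bool using (Bool; true; false)
open import Data.Vec using (sum; tabulate)
open import Data.Fin.Subset using (Subset; _∈_; ∣_∣)
open import Data.Integer as ℤ using (ℤ; +_)
open import Data.Product using (Σ; _×_; ∃; ∃-syntax)
open import Data.Sum using (_⊎_)
open import Relation.Binary.PropositionalEquality using (_≡_; _≢_)
open import Relation.Nullary using (¬_)

record Graph (n : ℕ) : Set where
  field
    adj   : Fin n → Fin n → Bool
    sym   : ∀ u v → adj u v ≡ adj v u
    irrefl : ∀ v → adj v v ≡ false

open Graph public

Adj : ∀ {n} → Graph n → Fin n → Fin n → Set
Adj G u v = adj G u v ≡ true

NoIsolated : ∀ {n} → Graph n → Set
NoIsolated {n} G = ∀ (v : Fin n) → ∃[ u ] Adj G v u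

val : ∀ {n} → (Fin n → Fin 3) → Fin n → ℕ
val f v = toℕ (f v)

weight : ∀ {n} → (Fin n → Fin 3) → ℕ
weight {n} f = sum (tabulate (val f))

IsTR2DF : ∀ {n} → Graph n → (Fin n → Fin 3) → Set
IsTR2DF {n} G f =
  (∀ (v : Fin n) → val f v ≡ 0 →
      (∃[ u ] (Adj G v u × val f u ≡ 2))
    ⊎ (∃[ x ] ∃[ y ] (x ≢ y × Adj G v x × Adj G v y × val f x ≡ 1 × val f y ≡ 1)))
  × (∀ (v : Fin n) → val f v ≢ 0 → ∃[ u ] (Adj G v u × val f u ≢ 0))

TR2Weights : ∀ {n} → Graph n → ℤ → Set
TR2Weights G z = ∃[ f ] (IsTR2DF G f × z ≡ + weight f)

data Opt : Set where
  min max : Opt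

IsOpt : Opt → (ℤ → Set) → ℤ → Set
IsOpt min S z = S z × (∀ w → S w → z ℤ.≤ w)
IsOpt max S z = S z × (∀ w → S w → w ℤ.≤ z)

-- MSOL(τ₁): de Bruijn syntax with v vertex variables and s set variables

data Formula (v s : ℕ) : Set where
  R    : Fin v → Fin v → Formula v s
  eqV  : Fin v → Fin v → Formula v s
  mem  : Fin v → Fin s → Formula v s
  ff   : Formula v s
  neg  : Formula v s → Formula v s
  and  : Formula v s → Formula v s → Formula v s
  or   : Formula v s → Formula v s → Formula v s
  imp  : Formula v s → Formula v s → Formula v s
  allV : Formula (suc v) s → Formula v s
  exV  : Formula (suc v) s → Formula v s
  allS : Formula v (suc s) → Formula v s
  exS  : Formula v (suc s) → Formula v s

extend : ∀ {k} {A : Set} → (Fin k → A) → A → Fin (suc k) → A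
extend ρ a Fin.zero    = a
extend ρ a (Fin.suc i) = ρ i

-- satisfaction in G(τ₁) = ⟨V(G), R⟩ under vertex / set assignments
Sat : ∀ {n v s} → Graph n → Formula v s → (Fin v → Fin n) → (Fin s → Subset n) → Set
Sat G (R x y)    ρ σ = Adj G (ρ x) (ρ y)
Sat G (eqV x y)  ρ σ = ρ x ≡ ρ y
Sat G (mem x X)  ρ σ = ρ x ∈ σ X
Sat G ff         ρ σ = ⊥ where open import Data.Empty using (⊥)
Sat G (neg φ)    ρ σ = ¬ Sat G φ ρ σ
Sat G (and φ ψ)  ρ σ = Sat G φ ρ σ × Sat G ψ ρ σ
Sat G (or φ ψ)   ρ σ = Sat G φ ρ σ ⊎ Sat G ψ ρ σ
Sat G (imp φ ψ)  ρ σ = Sat G φ ρ σ → Sat G ψ ρ σ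
Sat {n} G (allV φ) ρ σ = ∀ (a : Fin n) → Sat G φ (extend ρ a) σ
Sat {n} G (exV φ)  ρ σ = ∃[ a ] Sat G φ (extend ρ a) σ
Sat {n} G (allS φ) ρ σ = ∀ (A : Subset n) → Sat G φ ρ (extend σ A)
Sat {n} G (exS φ)  ρ σ = ∃[ A ] Sat G φ ρ (extend σ A)

noVars : ∀ {n} → Fin 0 → Fin n
noVars ()

Models : ∀ {n l} → Graph n → Formula 0 l → (Fin l → Subset n) → Set
Models G θ Xs = Sat G θ noVars Xs

linSum : ∀ {n} (l : ℕ) → (Fin l → ℤ) → (Fin l → Subset n) → ℤ
linSum zero    a Xs = + 0
linSum (suc l) a Xs = a Fin.zero ℤ.* + ∣ Xs Fin.zero ∣ ℤ.+ linSum l (λ i → a (Fin.suc i)) (λ i → Xs (Fin.suc i))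

LinEMSOLValues : ∀ {n l} → Graph n → (Fin l → ℤ) → Formula 0 l → ℤ → Set
LinEMSOLValues {n} {l} G a θ z = ∃[ Xs ] (Models G θ Xs × z ≡ linSum l a Xs)

IsLinEMSOL : (Dom : ∀ {n} → Graph n → Set) → (Val : ∀ {n} → Graph n → ℤ → Set) → Set
IsLinEMSOL Dom Val =
  ∃[ l ] Σ (Fin l → ℤ) λ a → Σ (Formula 0 l) λ θ → Σ Opt λ o →
    ∀ {n} (G : Graph n) → Dom G → ∀ (z : ℤ) →
      (Val G z → IsOpt o (LinEMSOLValues G a θ) z) × (IsOpt o (LinEMSOLValues G a θ) z → Val G z)

IsγtR2 : ∀ {n} → Graph n → ℤ → Set
IsγtR2 G z = IsOpt min (TR2Weights G) z

{-# OPTIONS --safe #-}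
-- A function f : V → {0,1,2} is determined by its classes V₁ and V₂, and its
-- weight is |V₁| + 2|V₂|.  The conditions for f to be a total Roman
-- {2}-dominating function only speak about adjacency and membership in V₁ and
-- V₂, so they are an MSOL formula θ(X₁, X₂) that also demands X₁ ∩ X₂ = ∅.
-- Hence the pairs satisfying θ are exactly the class pairs of the functions in
-- question, with the same values of |X₁| + 2|X₂|, and both minima coincide.
module Submission where

open import Defs hiding (sym)

open import Data.Bool using (Bool; true; false; T)
open import Data.Bool.Properties using (T-≡)
open import Data.Fin using (Fin; zero; suc; toℕ; #_)
open import Data.Fin.Subset using (Subset; _∈_; ∣_∣)
open import Data.Fin.Subset.Properties using (_∈?_; drop-there)
open import Data.Integer as ℤ using (ℤ; +_)
import Data.Integer.Properties as ℤ
open import Data.Nat as ℕ using (ℕ; _≡ᵇ_)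
open import Data.Nat.Properties using (≡ᵇ⇒≡; ≡⇒≡ᵇ)
open import Data.Nat.Tactic.RingSolver using (solve-∀)
open import Data.Product using (_×_; ∃-syntax; _,_; proj₁; map₂)
open import Data.Sum using (_⊎_; inj₁; inj₂)
open import Data.Sum.Function.Propositional using (_⊎-⇔_)
open import Data.Vec using (_∷_; []; lookup; tabulate; here; there)
open import Data.Vec.Properties using ([]=⇒lookup; lookup⇒[]=; lookup∘tabulate)
open import Function using (_∘_)
open import Function.Bundles using (_⇔_; mk⇔; Equivalence)
open import Function.Properties.Equivalence using () renaming (sym to ⇔-sym; trans to ⇔-trans)
open import Relation.Binary.PropositionalEquality
  using (_≡_; _≢_; refl; sym; trans; cong; cong₂; module ≡-Reasoning)
open import Relation.Nullary using (¬_; yes; no; contradiction)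
open import Relation.Unary using (_⊥′_; _∪_)

open Equivalence using (to; from)

private
  variable
    n : ℕ

toℕ≡0⇔ : (c : Fin 3) → toℕ c ≡ 0 ⇔ (toℕ c ≢ 1 × toℕ c ≢ 2)
toℕ≡0⇔ zero                = mk⇔ (λ _ → (λ ()) , (λ ())) (λ _ → refl)
toℕ≡0⇔ (suc zero)          = mk⇔ (λ ()) (λ (≢1 , _) → contradiction refl ≢1)
toℕ≡0⇔ (suc (suc zero))    = mk⇔ (λ ()) (λ (_ , ≢2) → contradiction refl ≢2)

toℕ≢0⇔ : (c : Fin 3) → toℕ c ≢ 0 ⇔ (toℕ c ≡ 1 ⊎ toℕ c ≡ 2)
toℕ≢0⇔ zero                = mk⇔ (λ ≢0 → contradiction refl ≢0) (λ { (inj₁ ()) ; (inj₂ ()) })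
toℕ≢0⇔ (suc zero)          = mk⇔ (λ _ → inj₁ refl) (λ _ ())
toℕ≢0⇔ (suc (suc zero))    = mk⇔ (λ _ → inj₂ refl) (λ _ ())

suc∈∷⇔∈ : ∀ {b} {A : Subset n} {v} → suc v ∈ b ∷ A ⇔ v ∈ A
suc∈∷⇔∈ = mk⇔ drop-there there

record Classes (f : Fin n → Fin 3) (A B : Subset n) : Set where
  field
    ones : ∀ v → val f v ≡ 1 ⇔ v ∈ A
    twos : ∀ v → val f v ≡ 2 ⇔ v ∈ B

open Classes

Classes-tail : ∀ {f : Fin (ℕ.suc n) → Fin 3} {a b A B} →
               Classes f (a ∷ A) (b ∷ B) → Classes (f ∘ suc) A B
Classes-tail cls .ones v = ⇔-trans (cls .ones (suc v)) suc∈∷⇔∈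
Classes-tail cls .twos v = ⇔-trans (cls .twos (suc v)) suc∈∷⇔∈

weight-Classes : ∀ {f : Fin n → Fin 3} {A B} → Classes f A B → weight f ≡ ∣ A ∣ ℕ.+ 2 ℕ.* ∣ B ∣
weight-Classes {A = []} {[]} _ = refl
weight-Classes {A = true ∷ A} {true ∷ B} cls =
  contradiction (trans (sym (from (cls .ones zero) here)) (from (cls .twos zero) here)) λ ()
weight-Classes {A = true ∷ A} {false ∷ B} cls =
  cong₂ ℕ._+_ (from (cls .ones zero) here) (weight-Classes (Classes-tail cls))
weight-Classes {A = false ∷ A} {true ∷ B} cls =
  trans (cong₂ ℕ._+_ (from (cls .twos zero) here) (weight-Classes (Classes-tail cls)))
        (2+[a+2b]≡a+2[1+b] ∣ A ∣ ∣ B ∣)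
  where
  2+[a+2b]≡a+2[1+b] : ∀ a b → 2 ℕ.+ (a ℕ.+ 2 ℕ.* b) ≡ a ℕ.+ 2 ℕ.* ℕ.suc b
  2+[a+2b]≡a+2[1+b] = solve-∀
weight-Classes {f = f} {false ∷ A} {false ∷ B} cls =
  cong₂ ℕ._+_ (from (toℕ≡0⇔ (f zero)) ((λ ()) ∘ to (cls .ones zero) , (λ ()) ∘ to (cls .twos zero)))
              (weight-Classes (Classes-tail cls))

∈-tabulate⇔ : ∀ {p : Fin n → Bool} {v} → v ∈ tabulate p ⇔ T (p v)
∈-tabulate⇔ {p = p} {v} = mk⇔
  (λ v∈ → from T-≡ (trans (sym (lookup∘tabulate p v)) ([]=⇒lookup v∈)))
  (λ t → lookup⇒[]= v _ (trans (lookup∘tabulate p v) (to T-≡ t)))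

level : (Fin n → Fin 3) → ℕ → Subset n
level f k = tabulate (λ v → val f v ≡ᵇ k)

∈-level⇔ : ∀ {f : Fin n → Fin 3} {k v} → v ∈ level f k ⇔ val f v ≡ k
∈-level⇔ {k = k} = ⇔-trans ∈-tabulate⇔ (mk⇔ (≡ᵇ⇒≡ _ k) (≡⇒≡ᵇ _ k))

Classes-level : ∀ {f : Fin n → Fin 3} → Classes f (level f 1) (level f 2)
Classes-level {f = f} .ones _ = ⇔-sym (∈-level⇔ {f = f})
Classes-level {f = f} .twos _ = ⇔-sym (∈-level⇔ {f = f})

labelling : Subset n → Subset n → Fin n → Fin 3
labelling A B v with v ∈? B | v ∈? A
... | yes _ | _     = # 2
... | no _  | yes _ = # 1
... | no _  | no _  = # 0

Classes-labelling : ∀ {A B : Subset n} → (_∈ A) ⊥′ (_∈ B) → Classes (labelling A B) A B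
Classes-labelling {A = A} {B} disjoint .ones v with v ∈? B | v ∈? A
... | yes v∈B | _       = mk⇔ (λ ()) (λ v∈A → contradiction (v∈A , v∈B) (disjoint v))
... | no _    | yes v∈A = mk⇔ (λ _ → v∈A) (λ _ → refl)
... | no _    | no v∉A  = mk⇔ (λ ()) (λ v∈A → contradiction v∈A v∉A)
Classes-labelling {A = A} {B} disjoint .twos v with v ∈? B | v ∈? A
... | yes v∈B | _       = mk⇔ (λ _ → v∈B) (λ _ → refl)
... | no v∉B  | yes _   = mk⇔ (λ ()) (λ v∈B → contradiction v∈B v∉B)
... | no v∉B  | no _    = mk⇔ (λ ()) (λ v∈B → contradiction v∈B v∉B)

Roman2Dominating : Graph n → (V₁ V₂ : Fin n → Set) → Set
Roman2Dominating G V₁ V₂ = ∀ v → ¬ V₁ v × ¬ V₂ v →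
  (∃[ u ] (Adj G v u × V₂ u)) ⊎ (∃[ x ] ∃[ y ] (x ≢ y × Adj G v x × Adj G v y × V₁ x × V₁ y))

InducesNoIsolated : Graph n → (Fin n → Set) → Set
InducesNoIsolated G V = ∀ v → V v → ∃[ u ] (Adj G v u × V u)

IsTR2Pair : Graph n → (V₁ V₂ : Fin n → Set) → Set
IsTR2Pair G V₁ V₂ = V₁ ⊥′ V₂ × Roman2Dominating G V₁ V₂ × InducesNoIsolated G (V₁ ∪ V₂)

IsTR2Pair-cong : ∀ {G : Graph n} {V₁ V₂ W₁ W₂} → (∀ v → V₁ v ⇔ W₁ v) → (∀ v → V₂ v ⇔ W₂ v) →
                 IsTR2Pair G V₁ V₂ → IsTR2Pair G W₁ W₂
IsTR2Pair-cong {G = G} {W₁ = W₁} {W₂} e₁ e₂ (disjoint , dominating , noIsolated) =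
  (λ v (w₁ , w₂) → disjoint v (from (e₁ v) w₁ , from (e₂ v) w₂)) ,
  dominating′ ,
  (λ v → map₂ (λ {u} → map₂ (to (e₁ u ⊎-⇔ e₂ u))) ∘ noIsolated v ∘ from (e₁ v ⊎-⇔ e₂ v))
  where
  dominating′ : Roman2Dominating G W₁ W₂
  dominating′ v (¬w₁ , ¬w₂) with dominating v (¬w₁ ∘ to (e₁ v) , ¬w₂ ∘ to (e₂ v))
  ... | inj₁ (u , vu , u₂) = inj₁ (u , vu , to (e₂ u) u₂)
  ... | inj₂ (x , y , x≢y , vx , vy , x₁ , y₁) = inj₂ (x , y , x≢y , vx , vy , to (e₁ x) x₁ , to (e₁ y) y₁)

IsTR2DF⇔IsTR2Pair : ∀ (G : Graph n) {f} → IsTR2DF G f ⇔ IsTR2Pair G (λ v → val f v ≡ 1) (λ v → val f v ≡ 2)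
IsTR2DF⇔IsTR2Pair G {f} = mk⇔
  (λ (dominating , noIsolated) →
    (λ v (v₁ , v₂) → contradiction (trans (sym v₁) v₂) λ ()) ,
    (λ v → dominating v ∘ from (toℕ≡0⇔ (f v))) ,
    (λ v → map₂ (λ {u} → map₂ (to (toℕ≢0⇔ (f u)))) ∘ noIsolated v ∘ from (toℕ≢0⇔ (f v))))
  (λ (_ , dominating , noIsolated) →
    (λ v → dominating v ∘ to (toℕ≡0⇔ (f v))) ,
    (λ v → map₂ (λ {u} → map₂ (from (toℕ≢0⇔ (f u)))) ∘ noIsolated v ∘ to (toℕ≢0⇔ (f v))))

X₁ X₂ : Fin 2
X₁ = # 0
X₂ = # 1

-- Vertex variables are de Bruijn indices: # 0 is the innermost bound vertex.
disjointφ : Formula 0 2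
disjointφ = allV (neg (and (mem (# 0) X₁) (mem (# 0) X₂)))

roman2Dominatingφ : Formula 0 2
roman2Dominatingφ = allV (imp (and (neg (mem (# 0) X₁)) (neg (mem (# 0) X₂)))
  (or (exV (and (R (# 1) (# 0)) (mem (# 0) X₂)))
      (exV (exV (and (neg (eqV (# 1) (# 0)))
                (and (R (# 2) (# 1)) (and (R (# 2) (# 0)) (and (mem (# 1) X₁) (mem (# 0) X₁)))))))))

inducesNoIsolatedφ : Formula 0 2
inducesNoIsolatedφ = allV (imp (or (mem (# 0) X₁) (mem (# 0) X₂))
  (exV (and (R (# 1) (# 0)) (or (mem (# 0) X₁) (mem (# 0) X₂)))))

θ : Formula 0 2
θ = and disjointφ (and roman2Dominatingφ inducesNoIsolatedφ)

-- Models G θ Xs unfolds definitionally to IsTR2Pair G (_∈ Xs X₁) (_∈ Xs X₂).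
IsTR2DF⇔Models-θ : ∀ (G : Graph n) {f} Xs → Classes f (Xs X₁) (Xs X₂) → IsTR2DF G f ⇔ Models G θ Xs
IsTR2DF⇔Models-θ G {f} _ cls = mk⇔
  (IsTR2Pair-cong {G = G} (cls .ones) (cls .twos) ∘ to (IsTR2DF⇔IsTR2Pair G {f}))
  (from (IsTR2DF⇔IsTR2Pair G {f}) ∘ IsTR2Pair-cong {G = G} (⇔-sym ∘ cls .ones) (⇔-sym ∘ cls .twos))

coefficients : Fin 2 → ℤ
coefficients zero       = + 1
coefficients (suc zero) = + 2

linSum-coefficients : (Xs : Fin 2 → Subset n) → linSum 2 coefficients Xs ≡ + (∣ Xs X₁ ∣ ℕ.+ 2 ℕ.* ∣ Xs X₂ ∣)
linSum-coefficients Xs = begin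
  + 1 ℤ.* + a ℤ.+ (+ 2 ℤ.* + b ℤ.+ + 0) ≡⟨ cong₂ ℤ._+_ (ℤ.*-identityˡ (+ a)) (ℤ.+-identityʳ (+ 2 ℤ.* + b)) ⟩
  + a ℤ.+ + 2 ℤ.* + b                   ≡⟨ cong (ℤ._+_ (+ a)) (ℤ.pos-* 2 b) ⟨
  + a ℤ.+ + (2 ℕ.* b)                   ≡⟨ ℤ.pos-+ a (2 ℕ.* b) ⟨
  + (a ℕ.+ 2 ℕ.* b)                     ∎
  where
  open ≡-Reasoning
  a = ∣ Xs X₁ ∣
  b = ∣ Xs X₂ ∣

weight≡linSum : ∀ {f : Fin n → Fin 3} Xs → Classes f (Xs X₁) (Xs X₂) → + weight f ≡ linSum 2 coefficients Xs
weight≡linSum Xs cls = trans (cong +_ (weight-Classes cls)) (sym (linSum-coefficients Xs))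

TR2Weights⇔LinEMSOLValues : (G : Graph n) (z : ℤ) → TR2Weights G z ⇔ LinEMSOLValues G coefficients θ z
TR2Weights⇔LinEMSOLValues G z = mk⇔
  (λ (f , isTR2DF , z≡w) →
    let Xs = lookup (level f 1 ∷ level f 2 ∷ [])
        cls = Classes-level {f = f}
    in Xs , to (IsTR2DF⇔Models-θ G Xs cls) isTR2DF , trans z≡w (weight≡linSum Xs cls))
  (λ (Xs , models , z≡l) →
    let cls = Classes-labelling (proj₁ models)
    in labelling (Xs X₁) (Xs X₂) , from (IsTR2DF⇔Models-θ G Xs cls) models , trans z≡l (sym (weight≡linSum Xs cls)))

IsOpt-cong : ∀ o {S T : ℤ → Set} → (∀ z → S z → T z) → (∀ z → T z → S z) → ∀ {z} → IsOpt o S z → IsOpt o T z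
IsOpt-cong min S⊆T T⊆S (s , optimal) = S⊆T _ s , λ w t → optimal w (T⊆S w t)
IsOpt-cong max S⊆T T⊆S (s , optimal) = S⊆T _ s , λ w t → optimal w (T⊆S w t)

IsOpt-⇔ : ∀ o {S T : ℤ → Set} → (∀ z → S z ⇔ T z) → ∀ z → IsOpt o S z ⇔ IsOpt o T z
IsOpt-⇔ o S⇔T z = mk⇔ (IsOpt-cong o (to ∘ S⇔T) (from ∘ S⇔T)) (IsOpt-cong o (from ∘ S⇔T) (to ∘ S⇔T))

-- The correspondence holds for every graph; excluding isolated vertices only
-- guarantees that total Roman {2}-dominating functions exist.
mainTheorem3 : IsLinEMSOL NoIsolated IsγtR2
mainTheorem3 = 2 , coefficients , θ , min , λ G _ z →
  let γ⇔opt = IsOpt-⇔ min (TR2Weights⇔LinEMSOLValues G) z in to γ⇔opt , from γ⇔opt
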